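{- Fix integers $n,r$ with $n/r\ge2$ and an integer $t\ge1$. Then $$g(n,r,s,t)=\sum_{i=s}^{2s-1}\left(\binom{i-1}{s-1}-\binom{i-t}{s-1}\right)\binom{n-i}{r-s}$$ is decreasing in $s$ (for $1\le s\le r$).
   Context: Binomial coefficients follow the convention $\binom{m}{k}=0$ if $k<0$ or $m<k$. -}

module Defs where

open import Data.Nat using (ℕ; zero; suc)
open import Data.Nat.Combinatorics using (_C_)
open import Data.Integer using (ℤ; +_; -[1+_]; _+_; _-_; _*_)

-- Binomial coefficient with integer arguments, convention: 0 if k < 0 or m < k
-- (the stdlib's  m C k  is already 0 when k > m).
binomℤ : ℤ → ℤ → ℤ
binomℤ (+ m) (+ k) = + (m C k)
binomℤ (+ m) -[1+ k ] = + 0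
binomℤ -[1+ m ] k = + 0

sumFrom : ℤ → ℕ → (ℤ → ℤ) → ℤ
sumFrom a zero f = + 0
sumFrom a (suc len) f = f a + sumFrom (a + + 1) len f

g : ℤ → ℤ → ℕ → ℤ → ℤ
g n r s t = sumFrom (+ s) s (λ i →
  (binomℤ (i - + 1) (+ s - + 1) - binomℤ (i - t) (+ s - + 1)) * binomℤ (n - i) (r - + s))

-- Write g(s) = W_s(1) − W_s(t) with W_s(u) = Σ_{i=s}^{2s−1} C(i−u, s−1) C(n−i, r−s).
-- Summation by parts, with Pascal's rule in both factors, collapses W_s(u) − W_{s+1}(u)
-- to the boundary term C(2s−u, s) C(M, k+1) − C(2s−u, s−1) C(M, k), where M = n−2s−1 and
-- k = r−s−1; the lower boundary term C(s−u, s) C(n−s, k+1) vanishes for u ≥ 1. Hence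
-- g(s) − g(s+1) is this boundary term at u = 1 minus its value at u = t, which is
-- nonnegative because C(2s−u, ·) decreases past its middle while C(M, ·) still increases
-- (M ≥ 2k+1 as n ≥ 2r).

module Submission where

open import Defs
open import Data.Nat using (ℕ; _≤_; _*_)
open import Data.Integer using (ℤ; +_)
import Data.Integer as ℤ

open import Data.Nat as ℕ using (zero; suc; _∸_; z≤n; _≤′_; ≤′-refl; ≤′-step; NonZero)
open import Data.Nat.Combinatorics using (_C_; nCk+nC[k+1]≡[n+1]C[k+1]; nC1≡n; k>n⇒nCk≡0)
open import Data.Nat.Properties
import Data.Nat.Tactic.RingSolver as ℕ-Solver
open import Data.Integer using (-[1+_]; _-_; +≤+; +<+)
import Data.Integer.Properties as ℤP
import Data.Integer.Tactic.RingSolver as ℤ-Solver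
open import Data.Product using (_,_)
open import Relation.Binary.PropositionalEquality

[1+n]C[1+k]≡nC[1+k]+nCk : ∀ n k → suc n C suc k ≡ n C suc k ℕ.+ n C k
[1+n]C[1+k]≡nC[1+k]+nCk n k = trans (sym (nCk+nC[k+1]≡[n+1]C[k+1] n k)) (+-comm (n C k) _)

[1+k]*nC[1+k]+k*nCk≡n*nCk : ∀ n k → suc k * (n C suc k) ℕ.+ k * (n C k) ≡ n * (n C k)
[1+k]*nC[1+k]+k*nCk≡n*nCk zero zero = refl
[1+k]*nC[1+k]+k*nCk≡n*nCk zero (suc k) = cong₂ ℕ._+_ (*-zeroʳ (suc (suc k))) (*-zeroʳ (suc k))
[1+k]*nC[1+k]+k*nCk≡n*nCk (suc n) zero =
  trans (+-identityʳ _) (trans (*-identityˡ _) (trans (nC1≡n (suc n)) (sym (*-identityʳ _))))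
[1+k]*nC[1+k]+k*nCk≡n*nCk (suc n) (suc k)
  rewrite [1+n]C[1+k]≡nC[1+k]+nCk n (suc k) | [1+n]C[1+k]≡nC[1+k]+nCk n k = begin
    suc (suc k) * (C₂ ℕ.+ C₁) ℕ.+ suc k * (C₁ ℕ.+ C₀)
  ≡⟨ regroup k C₀ C₁ C₂ ⟩
    (suc (suc k) * C₂ ℕ.+ suc k * C₁) ℕ.+ (suc k * C₁ ℕ.+ k * C₀) ℕ.+ C₁ ℕ.+ C₀
  ≡⟨ cong₂ (λ x y → x ℕ.+ y ℕ.+ C₁ ℕ.+ C₀)
           ([1+k]*nC[1+k]+k*nCk≡n*nCk n (suc k)) ([1+k]*nC[1+k]+k*nCk≡n*nCk n k) ⟩
    n * C₁ ℕ.+ n * C₀ ℕ.+ C₁ ℕ.+ C₀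
  ≡⟨ collect n C₀ C₁ ⟩
    suc n * (C₁ ℕ.+ C₀) ∎
  where
  open ≡-Reasoning
  C₀ = n C k
  C₁ = n C suc k
  C₂ = n C suc (suc k)
  regroup : ∀ k c₀ c₁ c₂ → suc (suc k) * (c₂ ℕ.+ c₁) ℕ.+ suc k * (c₁ ℕ.+ c₀)
            ≡ (suc (suc k) * c₂ ℕ.+ suc k * c₁) ℕ.+ (suc k * c₁ ℕ.+ k * c₀) ℕ.+ c₁ ℕ.+ c₀
  regroup = ℕ-Solver.solve-∀
  collect : ∀ n c₀ c₁ → n * c₁ ℕ.+ n * c₀ ℕ.+ c₁ ℕ.+ c₀ ≡ suc n * (c₁ ℕ.+ c₀)
  collect = ℕ-Solver.solve-∀

nC[1+k]≤nCk : ∀ n k → n ≤ suc (k ℕ.+ k) → n C suc k ≤ n C k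
nC[1+k]≤nCk n k n≤2k+1 = *-cancelˡ-≤ (suc k) (+-cancelʳ-≤ (k * (n C k)) _ _ (begin
    suc k * (n C suc k) ℕ.+ k * (n C k) ≡⟨ [1+k]*nC[1+k]+k*nCk≡n*nCk n k ⟩
    n * (n C k)                         ≤⟨ *-monoˡ-≤ (n C k) n≤2k+1 ⟩
    suc (k ℕ.+ k) * (n C k)             ≡⟨ *-distribʳ-+ (n C k) (suc k) k ⟩
    suc k * (n C k) ℕ.+ k * (n C k)     ∎))
  where open ≤-Reasoning

nCk≤nC[1+k] : ∀ n k → suc (k ℕ.+ k) ≤ n → n C k ≤ n C suc k
nCk≤nC[1+k] n k 2k+1≤n = *-cancelˡ-≤ (suc k) (+-cancelʳ-≤ (k * (n C k)) _ _ (begin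
    suc k * (n C k) ℕ.+ k * (n C k)     ≡⟨ *-distribʳ-+ (n C k) (suc k) k ⟨
    suc (k ℕ.+ k) * (n C k)             ≤⟨ *-monoˡ-≤ (n C k) 2k+1≤n ⟩
    n * (n C k)                         ≡⟨ [1+k]*nC[1+k]+k*nCk≡n*nCk n k ⟨
    suc k * (n C suc k) ℕ.+ k * (n C k) ∎))
  where open ≤-Reasoning

nCk≤[1+n]Ck : ∀ n k → n C k ≤ suc n C k
nCk≤[1+n]Ck n zero = ≤-refl
nCk≤[1+n]Ck n (suc k) rewrite [1+n]C[1+k]≡nC[1+k]+nCk n k = m≤m+n _ _

C-monoˡ-≤ : ∀ {m n} k → m ≤ n → m C k ≤ n C k
C-monoˡ-≤ k m≤n = go (≤⇒≤′ m≤n)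
  where
  go : ∀ {m n} → m ≤′ n → m C k ≤ n C k
  go ≤′-refl = ≤-refl
  go (≤′-step m≤′n) = ≤-trans (go m≤′n) (nCk≤[1+n]Ck _ k)

0≤binomℤ : ∀ m k → + 0 ℤ.≤ binomℤ m k
0≤binomℤ (+ m) (+ k) = +≤+ z≤n
0≤binomℤ (+ m) -[1+ k ] = +≤+ z≤n
0≤binomℤ -[1+ m ] k = +≤+ z≤n

binomℤ-pascal : ∀ m k → binomℤ (m ℤ.+ + 1) (+ suc k) ≡ binomℤ m (+ suc k) ℤ.+ binomℤ m (+ k)
binomℤ-pascal (+ m) k rewrite +-comm m 1 = cong +_ ([1+n]C[1+k]≡nC[1+k]+nCk m k)
binomℤ-pascal -[1+ zero ] k = refl
binomℤ-pascal -[1+ suc m ] k = refl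

binomℤ-vanishes : ∀ {m} k → m ℤ.< + k → binomℤ m (+ k) ≡ + 0
binomℤ-vanishes {+ m} k (+<+ m<k) = cong +_ (k>n⇒nCk≡0 m<k)
binomℤ-vanishes { -[1+ m ]} k _ = refl

binomℤ-monoˡ-≤ : ∀ {m n} k → m ℤ.≤ n → binomℤ m (+ k) ℤ.≤ binomℤ n (+ k)
binomℤ-monoˡ-≤ { -[1+ m ]} {n} k _ = 0≤binomℤ n (+ k)
binomℤ-monoˡ-≤ {+ m} {+ n} k (+≤+ m≤n) = +≤+ (C-monoˡ-≤ k m≤n)

binomℤ[m,1+k]≤binomℤ[m,k] : ∀ {m} k → m ℤ.≤ + suc (k ℕ.+ k) → binomℤ m (+ suc k) ℤ.≤ binomℤ m (+ k)
binomℤ[m,1+k]≤binomℤ[m,k] {+ m} k (+≤+ m≤2k+1) = +≤+ (nC[1+k]≤nCk m k m≤2k+1)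
binomℤ[m,1+k]≤binomℤ[m,k] { -[1+ m ]} k _ = ℤP.≤-refl

binomℤ[m,k]≤binomℤ[m,1+k] : ∀ {m} k → + suc (k ℕ.+ k) ℤ.≤ m → binomℤ m (+ k) ℤ.≤ binomℤ m (+ suc k)
binomℤ[m,k]≤binomℤ[m,1+k] {+ m} k (+≤+ 2k+1≤m) = +≤+ (nCk≤nC[1+k] m k 2k+1≤m)

sumFrom-cong : ∀ a len {f h : ℤ → ℤ} → (∀ i → f i ≡ h i) → sumFrom a len f ≡ sumFrom a len h
sumFrom-cong a zero f≗h = refl
sumFrom-cong a (suc len) f≗h = cong₂ ℤ._+_ (f≗h a) (sumFrom-cong (a ℤ.+ + 1) len f≗h)

sumFrom-sub : ∀ a len (f h : ℤ → ℤ) →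
  sumFrom a len (λ i → f i - h i) ≡ sumFrom a len f - sumFrom a len h
sumFrom-sub a zero f h = refl
sumFrom-sub a (suc len) f h =
  trans (cong (ℤ._+_ (f a - h a)) (sumFrom-sub (a ℤ.+ + 1) len f h)) (interchange (f a) (h a) _ _)
  where
  interchange : ∀ x y u v → (x - y) ℤ.+ (u - v) ≡ (x ℤ.+ u) - (y ℤ.+ v)
  interchange = ℤ-Solver.solve-∀

sumFrom-shift : ∀ a len (f : ℤ → ℤ) → sumFrom (a ℤ.+ + 1) len f ≡ sumFrom a len (λ i → f (i ℤ.+ + 1))
sumFrom-shift a zero f = refl
sumFrom-shift a (suc len) f = cong (ℤ._+_ (f (a ℤ.+ + 1))) (sumFrom-shift (a ℤ.+ + 1) len f)

a+1+n≡a+[1+n] : ∀ a n → a ℤ.+ + 1 ℤ.+ + n ≡ a ℤ.+ + suc n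
a+1+n≡a+[1+n] a n = ℤP.+-assoc a (+ 1) (+ n)

sumFrom-snoc : ∀ a len (f : ℤ → ℤ) → sumFrom a (suc len) f ≡ sumFrom a len f ℤ.+ f (a ℤ.+ + len)
sumFrom-snoc a zero f =
  trans (ℤP.+-identityʳ (f a)) (trans (cong f (sym (ℤP.+-identityʳ a))) (sym (ℤP.+-identityˡ _)))
sumFrom-snoc a (suc len) f = begin
    f a ℤ.+ sumFrom (a ℤ.+ + 1) (suc len) f
  ≡⟨ cong (ℤ._+_ (f a)) (sumFrom-snoc (a ℤ.+ + 1) len f) ⟩
    f a ℤ.+ (sumFrom (a ℤ.+ + 1) len f ℤ.+ f (a ℤ.+ + 1 ℤ.+ + len))
  ≡⟨ cong (λ i → f a ℤ.+ (sumFrom (a ℤ.+ + 1) len f ℤ.+ f i)) (a+1+n≡a+[1+n] a len) ⟩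
    f a ℤ.+ (sumFrom (a ℤ.+ + 1) len f ℤ.+ f (a ℤ.+ + suc len))
  ≡⟨ ℤP.+-assoc (f a) _ _ ⟨
    f a ℤ.+ sumFrom (a ℤ.+ + 1) len f ℤ.+ f (a ℤ.+ + suc len) ∎
  where open ≡-Reasoning

sumFrom-telescope : ∀ a len (P : ℤ → ℤ) →
  sumFrom a len (λ i → P (i ℤ.+ + 1) - P i) ≡ P (a ℤ.+ + len) - P a
sumFrom-telescope a zero P =
  trans (sym (ℤP.+-inverseʳ (P a))) (cong (λ i → P i - P a) (sym (ℤP.+-identityʳ a)))
sumFrom-telescope a (suc len) P = begin
    (P (a ℤ.+ + 1) - P a) ℤ.+ sumFrom (a ℤ.+ + 1) len (λ i → P (i ℤ.+ + 1) - P i)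
  ≡⟨ cong (ℤ._+_ (P (a ℤ.+ + 1) - P a)) (sumFrom-telescope (a ℤ.+ + 1) len P) ⟩
    (P (a ℤ.+ + 1) - P a) ℤ.+ (P (a ℤ.+ + 1 ℤ.+ + len) - P (a ℤ.+ + 1))
  ≡⟨ cong (λ i → (P (a ℤ.+ + 1) - P a) ℤ.+ (P i - P (a ℤ.+ + 1))) (a+1+n≡a+[1+n] a len) ⟩
    (P (a ℤ.+ + 1) - P a) ℤ.+ (P (a ℤ.+ + suc len) - P (a ℤ.+ + 1))
  ≡⟨ cancel (P (a ℤ.+ + 1)) (P a) (P (a ℤ.+ + suc len)) ⟩
    P (a ℤ.+ + suc len) - P a ∎
  where
  open ≡-Reasoning
  cancel : ∀ x y z → (x - y) ℤ.+ (z - x) ≡ z - y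
  cancel = ℤ-Solver.solve-∀

module _ (b B e e′ : ℤ → ℤ)
         (B-step : ∀ i → B (i ℤ.+ + 1) ≡ B i ℤ.+ b i)
         (e-step : ∀ i → e i ≡ e (i ℤ.+ + 1) ℤ.+ e′ (i ℤ.+ + 1)) where

  private
    P : ℤ → ℤ
    P i = B i ℤ.* e i

    term≡ΔP : ∀ i → b i ℤ.* e i - B (i ℤ.+ + 1) ℤ.* e′ (i ℤ.+ + 1) ≡ P (i ℤ.+ + 1) - P i
    term≡ΔP i = begin
        b i ℤ.* e i - B (i ℤ.+ + 1) ℤ.* e′ (i ℤ.+ + 1)
      ≡⟨ cong₂ (λ x y → b i ℤ.* x - y ℤ.* e′ (i ℤ.+ + 1)) (e-step i) (B-step i) ⟩
        b i ℤ.* (e (i ℤ.+ + 1) ℤ.+ e′ (i ℤ.+ + 1)) - (B i ℤ.+ b i) ℤ.* e′ (i ℤ.+ + 1)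
      ≡⟨ exchange (b i) (B i) (e (i ℤ.+ + 1)) (e′ (i ℤ.+ + 1)) ⟩
        (B i ℤ.+ b i) ℤ.* e (i ℤ.+ + 1) - B i ℤ.* (e (i ℤ.+ + 1) ℤ.+ e′ (i ℤ.+ + 1))
      ≡⟨ cong₂ (λ x y → x ℤ.* e (i ℤ.+ + 1) - B i ℤ.* y) (B-step i) (e-step i) ⟨
        P (i ℤ.+ + 1) - P i ∎
      where
      open ≡-Reasoning
      exchange : ∀ x X y y′ → x ℤ.* (y ℤ.+ y′) - (X ℤ.+ x) ℤ.* y′ ≡ (X ℤ.+ x) ℤ.* y - X ℤ.* (y ℤ.+ y′)
      exchange = ℤ-Solver.solve-∀

  sumFrom-by-parts : ∀ a len → let c = a ℤ.+ + len in
    sumFrom a len (λ i → b i ℤ.* e i) - sumFrom (a ℤ.+ + 1) (suc len) (λ i → B i ℤ.* e′ i)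
    ≡ B c ℤ.* e (c ℤ.+ + 1) - b c ℤ.* e′ (c ℤ.+ + 1) - B a ℤ.* e a
  sumFrom-by-parts a len = begin
      S - sumFrom (a ℤ.+ + 1) (suc len) (λ i → B i ℤ.* e′ i)
    ≡⟨ cong (S -_) (trans (sumFrom-shift a (suc len) (λ i → B i ℤ.* e′ i))
                          (sumFrom-snoc a len (λ i → B (i ℤ.+ + 1) ℤ.* e′ (i ℤ.+ + 1)))) ⟩
      S - (S′ ℤ.+ B (c ℤ.+ + 1) ℤ.* e′ (c ℤ.+ + 1))
    ≡⟨ sub-assoc S S′ _ ⟩
      (S - S′) - B (c ℤ.+ + 1) ℤ.* e′ (c ℤ.+ + 1)
    ≡⟨ cong (_- B (c ℤ.+ + 1) ℤ.* e′ (c ℤ.+ + 1)) (begin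
          S - S′
        ≡⟨ sumFrom-sub a len (λ i → b i ℤ.* e i) (λ i → B (i ℤ.+ + 1) ℤ.* e′ (i ℤ.+ + 1)) ⟨
          sumFrom a len (λ i → b i ℤ.* e i - B (i ℤ.+ + 1) ℤ.* e′ (i ℤ.+ + 1))
        ≡⟨ sumFrom-cong a len term≡ΔP ⟩
          sumFrom a len (λ i → P (i ℤ.+ + 1) - P i)
        ≡⟨ sumFrom-telescope a len P ⟩
          P c - P a ∎) ⟩
      (P c - P a) - B (c ℤ.+ + 1) ℤ.* e′ (c ℤ.+ + 1)
    ≡⟨ cong₂ (λ x y → (B c ℤ.* x - P a) - y ℤ.* e′ (c ℤ.+ + 1)) (e-step c) (B-step c) ⟩
      (B c ℤ.* (e (c ℤ.+ + 1) ℤ.+ e′ (c ℤ.+ + 1)) - P a) - (B c ℤ.+ b c) ℤ.* e′ (c ℤ.+ + 1)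
    ≡⟨ collect (B c) (b c) (e (c ℤ.+ + 1)) (e′ (c ℤ.+ + 1)) (P a) ⟩
      B c ℤ.* e (c ℤ.+ + 1) - b c ℤ.* e′ (c ℤ.+ + 1) - P a ∎
    where
    open ≡-Reasoning
    c = a ℤ.+ + len
    S = sumFrom a len (λ i → b i ℤ.* e i)
    S′ = sumFrom a len (λ i → B (i ℤ.+ + 1) ℤ.* e′ (i ℤ.+ + 1))
    sub-assoc : ∀ x y z → x - (y ℤ.+ z) ≡ (x - y) - z
    sub-assoc = ℤ-Solver.solve-∀
    collect : ∀ X x y y′ p → (X ℤ.* (y ℤ.+ y′) - p) - (X ℤ.+ x) ℤ.* y′ ≡ X ℤ.* y - x ℤ.* y′ - p
    collect = ℤ-Solver.solve-∀

binomSum : (N k σ : ℕ) → ℤ → ℤ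
binomSum N k σ u = sumFrom (+ suc σ) (suc σ) (λ i → binomℤ (i - u) (+ σ) ℤ.* binomℤ (+ N - i) (+ k))

[+m+n]-[+m]≡+n : ∀ m n → + (m ℕ.+ n) - + m ≡ + n
[+m+n]-[+m]≡+n m n =
  trans (ℤP.[+m]-[+n]≡m⊖n (m ℕ.+ n) m) (trans (ℤP.⊖-≥ (m≤m+n m n)) (cong +_ (m+n∸m≡n m n)))

g≡binomSum-binomSum : ∀ N k σ t →
  g (+ N) (+ (suc σ ℕ.+ k)) (suc σ) (+ t) ≡ binomSum N k σ (+ 1) - binomSum N k σ (+ t)
g≡binomSum-binomSum N k σ t =
  trans (sumFrom-cong (+ suc σ) (suc σ) distrib) (sumFrom-sub (+ suc σ) (suc σ) (term (+ 1)) (term (+ t)))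
  where
  term : ℤ → ℤ → ℤ
  term u i = binomℤ (i - u) (+ σ) ℤ.* binomℤ (+ N - i) (+ k)
  sub-distrib : ∀ x y z → (x - y) ℤ.* z ≡ x ℤ.* z - y ℤ.* z
  sub-distrib = ℤ-Solver.solve-∀
  distrib : ∀ i →
    (binomℤ (i - + 1) (+ σ) - binomℤ (i - + t) (+ σ)) ℤ.* binomℤ (+ N - i) (+ (suc σ ℕ.+ k) - + suc σ)
    ≡ binomℤ (i - + 1) (+ σ) ℤ.* binomℤ (+ N - i) (+ k) - binomℤ (i - + t) (+ σ) ℤ.* binomℤ (+ N - i) (+ k)
  distrib i rewrite [+m+n]-[+m]≡+n (suc σ) k =
    sub-distrib (binomℤ (i - + 1) (+ σ)) (binomℤ (i - + t) (+ σ)) (binomℤ (+ N - i) (+ k))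

boundaryTerm : (N K σ : ℕ) → ℤ → ℤ
boundaryTerm N K σ u =
  binomℤ (+ (s ℕ.+ s) - u) (+ s) ℤ.* binomℤ (+ N - + (s ℕ.+ s ℕ.+ 1)) (+ suc K)
  - binomℤ (+ (s ℕ.+ s) - u) (+ σ) ℤ.* binomℤ (+ N - + (s ℕ.+ s ℕ.+ 1)) (+ K)
  where s = suc σ

binomSum-by-parts : ∀ N K σ u → .{{NonZero u}} →
  binomSum N (suc K) σ (+ u) - binomSum N K (suc σ) (+ u) ≡ boundaryTerm N K σ (+ u)
binomSum-by-parts N K σ u = begin
    binomSum N (suc K) σ (+ u) - binomSum N K (suc σ) (+ u)
  ≡⟨ cong (λ a → binomSum N (suc K) σ (+ u) - sumFrom a (suc (suc σ)) (λ i → B i ℤ.* e′ i))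
          (ℤP.+-comm (+ 1) (+ suc σ)) ⟩
    binomSum N (suc K) σ (+ u) - sumFrom (+ suc σ ℤ.+ + 1) (suc (suc σ)) (λ i → B i ℤ.* e′ i)
  ≡⟨ sumFrom-by-parts b B e e′ B-step e-step (+ suc σ) (suc σ) ⟩
    boundaryTerm N K σ (+ u) - B (+ suc σ) ℤ.* e (+ suc σ)
  ≡⟨ cong (λ x → boundaryTerm N K σ (+ u) - x ℤ.* e (+ suc σ)) lower-vanishes ⟩
    boundaryTerm N K σ (+ u) - + 0 ℤ.* e (+ suc σ)
  ≡⟨ ℤP.+-identityʳ _ ⟩
    boundaryTerm N K σ (+ u) ∎
  where
  open ≡-Reasoning
  b B e e′ : ℤ → ℤ
  b i = binomℤ (i - + u) (+ σ)
  B i = binomℤ (i - + u) (+ suc σ)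
  e i = binomℤ (+ N - i) (+ suc K)
  e′ i = binomℤ (+ N - i) (+ K)
  shift₁ : ∀ i u → i ℤ.+ + 1 - u ≡ (i - u) ℤ.+ + 1
  shift₁ = ℤ-Solver.solve-∀
  shift₂ : ∀ n i → n - i ≡ (n - (i ℤ.+ + 1)) ℤ.+ + 1
  shift₂ = ℤ-Solver.solve-∀
  B-step : ∀ i → B (i ℤ.+ + 1) ≡ B i ℤ.+ b i
  B-step i = trans (cong (λ m → binomℤ m (+ suc σ)) (shift₁ i (+ u))) (binomℤ-pascal (i - + u) σ)
  e-step : ∀ i → e i ≡ e (i ℤ.+ + 1) ℤ.+ e′ (i ℤ.+ + 1)
  e-step i = trans (cong (λ m → binomℤ m (+ suc K)) (shift₂ (+ N) i)) (binomℤ-pascal (+ N - (i ℤ.+ + 1)) K)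
  lower-vanishes : B (+ suc σ) ≡ + 0
  lower-vanishes = binomℤ-vanishes (suc σ)
    (subst (ℤ._< + suc σ) (sym (ℤP.[+m]-[+n]≡m⊖n (suc σ) u)) (ℤP.m⊖1+n<m (suc σ) u))

0≤i*j : ∀ {i j} → + 0 ℤ.≤ i → + 0 ℤ.≤ j → + 0 ℤ.≤ i ℤ.* j
0≤i*j {+ m} {+ n} _ _ = subst (+ 0 ℤ.≤_) (ℤP.pos-* m n) (+≤+ z≤n)

A₁X₁-A₀X₀≤B₁X₁-B₀X₀ : ∀ {B₁ B₀ A₁ A₀ X₁ X₀ : ℤ} →
  B₀ ℤ.≤ B₁ → A₁ ℤ.≤ B₁ → A₁ ℤ.≤ A₀ → X₀ ℤ.≤ X₁ → + 0 ℤ.≤ X₀ →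
  A₁ ℤ.* X₁ - A₀ ℤ.* X₀ ℤ.≤ B₁ ℤ.* X₁ - B₀ ℤ.* X₀
A₁X₁-A₀X₀≤B₁X₁-B₀X₀ {B₁} {B₀} {A₁} {A₀} {X₁} {X₀} B₀≤B₁ A₁≤B₁ A₁≤A₀ X₀≤X₁ 0≤X₀ =
  ℤP.0≤i-j⇒j≤i (subst (+ 0 ℤ.≤_) (expand B₁ B₀ A₁ A₀ X₁ X₀)
    (ℤP.+-mono-≤ (ℤP.+-mono-≤ (0≤i*j (ℤP.i≤j⇒0≤j-i A₁≤B₁) (ℤP.i≤j⇒0≤j-i X₀≤X₁))
                               (0≤i*j (ℤP.i≤j⇒0≤j-i A₁≤A₀) 0≤X₀))
                 (0≤i*j (ℤP.i≤j⇒0≤j-i B₀≤B₁) 0≤X₀)))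
  where
  expand : ∀ B₁ B₀ A₁ A₀ X₁ X₀ →
    (B₁ - A₁) ℤ.* (X₁ - X₀) ℤ.+ (A₀ - A₁) ℤ.* X₀ ℤ.+ (B₁ - B₀) ℤ.* X₀
    ≡ (B₁ ℤ.* X₁ - B₀ ℤ.* X₀) - (A₁ ℤ.* X₁ - A₀ ℤ.* X₀)
  expand = ℤ-Solver.solve-∀

boundaryTerm-antitone : ∀ N K σ t → 1 ≤ t → suc (K ℕ.+ K) ℕ.+ (suc σ ℕ.+ suc σ ℕ.+ 1) ≤ N →
  boundaryTerm N K σ (+ t) ℤ.≤ boundaryTerm N K σ (+ 1)
boundaryTerm-antitone N K σ t 1≤t hN =
  A₁X₁-A₀X₀≤B₁X₁-B₀X₀
    (binomℤ[m,k]≤binomℤ[m,1+k] σ (+≤+ (≤-reflexive (sym (+-suc σ σ)))))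
    (binomℤ-monoˡ-≤ (suc σ) mₜ≤m₁)
    (binomℤ[m,1+k]≤binomℤ[m,k] σ (ℤP.≤-trans mₜ≤m₁ (+≤+ (≤-reflexive (+-suc σ σ)))))
    (binomℤ[m,k]≤binomℤ[m,1+k] K (subst (+ suc (K ℕ.+ K) ℤ.≤_) (sym M≡N∸[2s+1])
                                        (+≤+ (m+n≤o⇒m≤o∸n (suc (K ℕ.+ K)) hN))))
    (0≤binomℤ _ _)
  where
  s = suc σ
  mₜ≤m₁ : + (s ℕ.+ s) - + t ℤ.≤ + (σ ℕ.+ s)
  mₜ≤m₁ = subst (ℤ._≤ + (σ ℕ.+ s)) (sym (ℤP.[+m]-[+n]≡m⊖n (s ℕ.+ s) t)) (ℤP.⊖-monoʳ-≥-≤ (s ℕ.+ s) 1≤t)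
  M≡N∸[2s+1] : + N - + (s ℕ.+ s ℕ.+ 1) ≡ + (N ∸ (s ℕ.+ s ℕ.+ 1))
  M≡N∸[2s+1] = trans (ℤP.[+m]-[+n]≡m⊖n N (s ℕ.+ s ℕ.+ 1)) (ℤP.⊖-≥ (m+n≤o⇒n≤o (suc (K ℕ.+ K)) hN))

g[2+σ]≤g[1+σ] : ∀ N K σ t → 1 ≤ t → 2 * (suc (suc σ) ℕ.+ K) ≤ N →
  g (+ N) (+ (suc (suc σ) ℕ.+ K)) (suc (suc σ)) (+ t) ℤ.≤ g (+ N) (+ (suc (suc σ) ℕ.+ K)) (suc σ) (+ t)
g[2+σ]≤g[1+σ] N K σ t@(suc _) 1≤t 2r≤N = ℤP.0≤i-j⇒j≤i (begin
    + 0
  ≤⟨ ℤP.i≤j⇒0≤j-i (boundaryTerm-antitone N K σ t 1≤t (≤-trans (≤-reflexive (room σ K)) 2r≤N)) ⟩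
    boundaryTerm N K σ (+ 1) - boundaryTerm N K σ (+ t)
  ≡⟨ cong₂ _-_ (binomSum-by-parts N K σ 1) (binomSum-by-parts N K σ t) ⟨
    (W₁ (+ 1) - W₂ (+ 1)) - (W₁ (+ t) - W₂ (+ t))
  ≡⟨ interchange (W₁ (+ 1)) (W₂ (+ 1)) (W₁ (+ t)) (W₂ (+ t)) ⟩
    (W₁ (+ 1) - W₁ (+ t)) - (W₂ (+ 1) - W₂ (+ t))
  ≡⟨ cong₂ _-_ g[1+σ]≡ (g≡binomSum-binomSum N K (suc σ) t) ⟨
    g (+ N) (+ r) (suc σ) (+ t) - g (+ N) (+ r) (suc (suc σ)) (+ t) ∎)
  where
  open ℤP.≤-Reasoning
  r = suc (suc σ) ℕ.+ K
  W₁ W₂ : ℤ → ℤ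
  W₁ = binomSum N (suc K) σ
  W₂ = binomSum N K (suc σ)
  room : ∀ σ K → suc (K ℕ.+ K) ℕ.+ (suc σ ℕ.+ suc σ ℕ.+ 1) ≡ 2 * (suc (suc σ) ℕ.+ K)
  room = ℕ-Solver.solve-∀
  interchange : ∀ a b c d → (a - b) - (c - d) ≡ (a - c) - (b - d)
  interchange = ℤ-Solver.solve-∀
  g[1+σ]≡ : g (+ N) (+ r) (suc σ) (+ t) ≡ W₁ (+ 1) - W₁ (+ t)
  g[1+σ]≡ = subst (λ r → g (+ N) (+ r) (suc σ) (+ t) ≡ W₁ (+ 1) - W₁ (+ t))
                  (+-suc (suc σ) K) (g≡binomSum-binomSum N (suc K) σ t)

g-suc≤g : ∀ {n r t s} → 2 * r ≤ n → 1 ≤ t → 1 ≤ s → suc s ≤ r →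
  g (+ n) (+ r) (suc s) (+ t) ℤ.≤ g (+ n) (+ r) s (+ t)
g-suc≤g {s = suc σ} 2r≤n 1≤t _ s<r with m≤n⇒∃[o]m+o≡n s<r
... | K , refl = g[2+σ]≤g[1+σ] _ K σ _ 1≤t 2r≤n

antitone-between : ∀ {lo hi} (f : ℕ → ℤ) → (∀ {k} → lo ≤ k → suc k ≤ hi → f (suc k) ℤ.≤ f k) →
  ∀ {s s′} → lo ≤ s → s ≤ s′ → s′ ≤ hi → f s′ ℤ.≤ f s
antitone-between {lo} {hi} f step {s} lo≤s s≤s′ = go (≤⇒≤′ s≤s′)
  where
  go : ∀ {s′} → s ≤′ s′ → s′ ≤ hi → f s′ ℤ.≤ f s
  go ≤′-refl _ = ℤP.≤-refl
  go (≤′-step s≤′k) k<hi =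
    ℤP.≤-trans (step (≤-trans lo≤s (≤′⇒≤ s≤′k)) k<hi) (go s≤′k (≤-trans (n≤1+n _) k<hi))

lemma15 : (n r t : ℕ) → 2 * r ≤ n → 1 ≤ t →
    (s s′ : ℕ) → 1 ≤ s → s ≤ s′ → s′ ≤ r →
    g (+ n) (+ r) s′ (+ t) ℤ.≤ g (+ n) (+ r) s (+ t)
lemma15 n r t 2r≤n 1≤t s s′ 1≤s s≤s′ s′≤r =
  antitone-between (λ k → g (+ n) (+ r) k (+ t)) (g-suc≤g 2r≤n 1≤t) 1≤s s≤s′ s′≤r
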